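{- Let $H$ be an ordered graph. Then $\chi^*_{cr}(H)=\chi^*_{cr}(1,H)$.
   Context: An ordered graph on $h$ vertices is a graph with vertex set $[h]$ (ordered naturally); an ordered graph $G$ contains $H$ if there is an order-preserving injection $V(H)\to V(G)$ mapping edges to edges. An $H$-tiling is a collection of vertex-disjoint copies of $H$; perfect if it covers all vertices; an $(x,H)$-tiling in $G$ is an $H$-tiling covering at least $x|G|$ vertices. For sets of integers, $X<Y$ means $a<b$ for all $a\in X,b\in Y$. For a complete $k$-partite unordered graph $B$ with parts $U_1,\dots,U_k$ and a permutation $\sigma$ of $[k]$, an interval labelling w.r.t. $\sigma$ is a bijection $\phi:V(B)\to[|B|]$ with $\phi(U_i)<\phi(U_j)$ when $\sigma(i)<\sigma(j)$, giving an ordered graph $(B,\phi)$; the ordered blow-up $(B(t),\phi)$ replaces each vertex $x$ by $t$ independent vertices $V_x$ (complete bipartite between $V_x,V_y$ when $xy\in E(B)$) ordered so that $V_x<V_y$ when $\phi(x)<\phi(y)$. $B$ is a bottlegraph of $H$ if for every such $\sigma,\phi$ there is $t$ with $(B(t),\phi)$ containing a perfect $H$-tiling. For $x\in(0,1]$, $B$ is an $x$-bottlegraph of $H$ if it is complete $k$-partite with parts $U_1,\dots,U_k$, there is $m$ with $|U_1|\le m$ and $|U_i|=m$ for $i>1$, and for every $\sigma$ and interval labelling $\phi$ w.r.t. $\sigma$, $(B,\phi)$ contains an $(x,H)$-tiling. For unordered $F$, $\chi_{cr}(F)=(\chi(F)-1)|F|/(|F|-\sigma(F))$, with $\sigma(F)$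 the least size of a colour class over proper $\chi(F)$-colourings. $\chi^*_{cr}(H)=\inf\{\chi_{cr}(B):B\text{ a bottlegraph of }H\}$ and $\chi^*_{cr}(x,H)=\inf\{\chi_{cr}(B):B\text{ an }x\text{ -bottlegraph of }H\}$. -}

module Defs where

open import Data.Nat using (ℕ; zero; suc; _+_; _*_; _∸_; _≤_; _<_; NonZero)
import Data.Fin as Fin
open import Data.Fin using (Fin; toℕ; quotient) renaming (_<_ to _<ᶠ_; _≟_ to _≟ᶠ_)
open import Data.Fin.Permutation using (Permutation′; _⟨$⟩ʳ_; _⟨$⟩ˡ_)
open import Data.Integer using (+_)
open import Data.Rational using (ℚ; _/_) renaming (_≤_ to _≤ℚ_; _*_ to _*ℚ_)
open import Data.Product using (Σ; ∃; ∃-syntax; _×_; _,_)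
open import Data.Bool using (Bool; true; false; if_then_else_)
open import Relation.Nullary using (¬_; does)
open import Relation.Binary.PropositionalEquality using (_≡_; _≢_; refl)
open import Function.Bundles using (_⇔_)

count : ∀ {n} → (Fin n → Bool) → ℕ
count {zero}  p = 0
count {suc n} p = (if p Fin.zero then 1 else 0) + count (λ i → p (Fin.suc i))

ℕtoℚ : ℕ → ℚ
ℕtoℚ n = (+ n) / 1

record Graph : Set₁ where
  field
    n   : ℕ
    Adj : Fin n → Fin n → Set

open Graph public

ProperColouring : (F : Graph) (c : ℕ) → (Fin (n F) → Fin c) → Set
ProperColouring F c col = ∀ u v → Adj F u v → col u ≢ col v

Colourable : Graph → ℕ → Set
Colourable F c = ∃[ col ] ProperColouring F c col

IsChromaticNumber : Graph → ℕ → Set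
IsChromaticNumber F k = Colourable F k × (∀ c → Colourable F c → k ≤ c)

classSize : (F : Graph) {c : ℕ} → (Fin (n F) → Fin c) → Fin c → ℕ
classSize F col j = count (λ v → does (col v ≟ᶠ j))

AchievesClassSize : Graph → ℕ → ℕ → Set
AchievesClassSize F k s =
  ∃[ col ] (ProperColouring F k col × ∃[ j ] classSize F col j ≡ s)

IsSigma : Graph → ℕ → Set
IsSigma F s = ∃[ k ] (IsChromaticNumber F k
                × AchievesClassSize F k s
                × (∀ s' → AchievesClassSize F k s' → s ≤ s'))

-- χ_cr(F) = q, i.e. q = (χ(F) - 1)|F| / (|F| - σ(F)); only defined when |F| > σ(F)
IsChiCr : Graph → ℚ → Set
IsChiCr F q = ∃[ k ] ∃[ s ] (IsChromaticNumber F k × IsSigma F s × s < n F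
               × q *ℚ ℕtoℚ (n F ∸ s) ≡ ℕtoℚ ((k ∸ 1) * n F))

record OrderedGraph : Set₁ where
  field
    size  : ℕ
    E     : Fin size → Fin size → Set
    Esym  : ∀ u v → E u v → E v u
    Eirr  : ∀ u → ¬ E u u

open OrderedGraph public

IsEmbedding : (H G : OrderedGraph) → (Fin (size H) → Fin (size G)) → Set
IsEmbedding H G f =
  (∀ a b → a <ᶠ b → f a <ᶠ f b) × (∀ a b → E H a b → E G (f a) (f b))

record Tiling (H G : OrderedGraph) : Set where
  field
    copies   : ℕ
    emb      : Fin copies → Fin (size H) → Fin (size G)
    isEmb    : ∀ j → IsEmbedding H G (emb j)
    disjoint : ∀ j j' a b → emb j a ≡ emb j' b → j ≡ j'

open Tiling public

covered : ∀ {H G} → Tiling H G → ℕ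
covered {H} T = copies T * size H

PerfectTiling : OrderedGraph → OrderedGraph → Set
PerfectTiling H G = Σ (Tiling H G) λ T → ∀ v → ∃[ j ] ∃[ a ] emb T j a ≡ v

XTiling : ℚ → OrderedGraph → OrderedGraph → Set
XTiling x H G = Σ (Tiling H G) λ T → x *ℚ ℕtoℚ (size G) ≤ℚ ℕtoℚ (covered T)

-- complete k-partite graph on vertex set Fin N; part v is the part containing v
record Multipartite : Set where
  field
    k    : ℕ
    N    : ℕ
    part : Fin N → Fin k

open Multipartite public

partSize : (B : Multipartite) → Fin (k B) → ℕ
partSize B i = count (λ v → does (part B v ≟ᶠ i))

asGraph : Multipartite → Graph
asGraph B = record { n = N B ; Adj = λ u v → part B u ≢ part B v }

-- φ : V(B) → [|B|] is a bijection (φ = ⟨$⟩ʳ), interval labelling w.r.t. σ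
IsIntervalLabelling : (B : Multipartite) → Permutation′ (k B) → Permutation′ (N B) → Set
IsIntervalLabelling B σ φ =
  ∀ u v → (σ ⟨$⟩ʳ part B u) <ᶠ (σ ⟨$⟩ʳ part B v) → (φ ⟨$⟩ʳ u) <ᶠ (φ ⟨$⟩ʳ v)

-- the ordered graph (B(t), φ): position p lies in the block of the
-- vertex φ⁻¹(⌊p / t⌋); blocks are consecutive intervals of length t
blowupEdge : (B : Multipartite) → Permutation′ (N B) → (t : ℕ) →
             Fin (N B * t) → Fin (N B * t) → Set
blowupEdge B φ t p q =
  part B (φ ⟨$⟩ˡ quotient t p) ≢ part B (φ ⟨$⟩ˡ quotient t q)

blowupSym : ∀ B φ t p q → blowupEdge B φ t p q → blowupEdge B φ t q p
blowupSym B φ t p q ne eq = ne (Relation.Binary.PropositionalEquality.sym eq)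

blowupIrr : ∀ B φ t p → ¬ blowupEdge B φ t p p
blowupIrr B φ t p ne = ne refl

orderedBlowup : (B : Multipartite) → Permutation′ (N B) → ℕ → OrderedGraph
orderedBlowup B φ t = record
  { size = N B * t ; E = blowupEdge B φ t
  ; Esym = blowupSym B φ t ; Eirr = blowupIrr B φ t }

-- the ordered graph (B, φ) itself (= B(1) up to identification)
orderedB : (B : Multipartite) → Permutation′ (N B) → OrderedGraph
orderedB B φ = record
  { size = N B
  ; E = λ p q → part B (φ ⟨$⟩ˡ p) ≢ part B (φ ⟨$⟩ˡ q)
  ; Esym = λ p q ne eq → ne (Relation.Binary.PropositionalEquality.sym eq)
  ; Eirr = λ p ne → ne refl }

IsBottlegraph : OrderedGraph → Multipartite → Set
IsBottlegraph H B =
  ∀ (σ : Permutation′ (k B)) (φ : Permutation′ (N B)) → IsIntervalLabelling B σ φ →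
  ∃[ t ] (1 ≤ t × PerfectTiling H (orderedBlowup B φ t))

IsXBottlegraph : ℚ → OrderedGraph → Multipartite → Set
IsXBottlegraph x H B =
  (∃[ m ] ∀ (i : Fin (k B)) →
      (toℕ i ≡ 0 → partSize B i ≤ m) × (¬ toℕ i ≡ 0 → partSize B i ≡ m))
  × (∀ (σ : Permutation′ (k B)) (φ : Permutation′ (N B)) → IsIntervalLabelling B σ φ →
       XTiling x H (orderedB B φ))

-- χ*_cr(H) and χ*_cr(x,H) as infima, described by their rational lower bounds

LowerBoundChiStar : OrderedGraph → ℚ → Set
LowerBoundChiStar H q =
  ∀ (B : Multipartite) (r : ℚ) → IsBottlegraph H B → IsChiCr (asGraph B) r → q ≤ℚ r

LowerBoundChiStarX : ℚ → OrderedGraph → ℚ → Set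
LowerBoundChiStarX x H q =
  ∀ (B : Multipartite) (r : ℚ) → IsXBottlegraph x H B → IsChiCr (asGraph B) r → q ≤ℚ r

-- A 1-bottlegraph is a bottlegraph with t = 1. Conversely, let B be a bottlegraph with χ(B) = K + 1 whose
-- smallest colour class, of size s, is colour 0. Each injective relabelling g of the colours gives an interval
-- labelling of B that orders the vertices by their new colour, hence a perfect tiling of some blow-up B(t_g);
-- a common multiple T of all the t_g serves every g at once. Let B′ consist of K copies of B(T), where copy j
-- sends colour 0 to part 0 and colour 1 + c to part 1 + (j + c mod K). Part 0 of B′ has K T s vertices and every
-- other part T (|B| - s), so B′ has the shape of a 1-bottlegraph and χ_cr(B′) = χ_cr(B). For an interval
-- labelling of B′, copy j ordered by the induced order of its colours is perfectly tileable, and each level of B′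
-- has exactly as many vertices as the corresponding levels of the copies together, so the copies can be laid
-- out side by side, level by level.

module Submission where

open import Defs
import Data.Nat.Properties
open import Algebra.Properties.CommutativeSemigroup Data.Nat.Properties.+-commutativeSemigroup using (interchange)
open import Algebra.Properties.Semiring.Sum Data.Nat.Properties.+-*-semiring
  using (sum; sum-syntax; ∑-comm; *-distribˡ-sum; sum-cong-≗; sum-permute)
open import Data.Bool using (Bool; true; false; if_then_else_)
open import Data.Empty using (⊥-elim)
open import Data.Fin as Fin
  using (Fin; zero; suc; toℕ; punchOut; splitAt; join; combine; quotient; remainder; funToFin; finToFun; _↑ˡ_; _↑ʳ_)
import Data.Fin.Properties as Finₚ
open import Data.Fin.Permutation
  using (Permutation′; permutation; flip; transpose; _⟨$⟩ʳ_; _⟨$⟩ˡ_; inverseˡ; inverseʳ)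
import Data.Integer as ℤ
import Data.Integer.Properties as ℤₚ
open import Data.Nat
  using (ℕ; zero; suc; _+_; _*_; _∸_; _≤_; _<_; z≤n; s≤s; s≤s⁻¹; _<?_; _≟_; NonZero; >-nonZero)
open import Data.Nat.Properties
open import Data.Nat.DivMod using (_mod_; _%_; m%n<n; %-distribˡ-+; m<n⇒m%n≡m; [m+n]%n≡m%n)
open import Data.Nat.Divisibility using (_∣_; divides; ∣-trans; m∣m*n; n∣m*n)
import Data.Nat.Coprimality as Coprime
open import Data.Nat.Tactic.RingSolver using (solve-∀)
open import Data.Product using (∃; Σ; _×_; _,_; proj₁; proj₂)
open import Data.Rational as ℚ using (ℚ; mkℚ; 1ℚ)
import Data.Rational.Properties as ℚₚ
open import Data.Sum using (_⊎_; inj₁; inj₂; [_,_]′)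
open import Data.Unit using (tt)
open import Function using (_∘_; _⇔_; mk⇔; Equivalence)
open import Function.Definitions using (Injective)
open import Relation.Nullary using (¬_; Dec; yes; no; does)
open import Relation.Nullary.Decidable using (dec-true; dec-false; does-⇔; map′; _⊎-dec_; _×-dec_; _→-dec_; ¬?)
open import Relation.Binary.PropositionalEquality
open import Relation.Binary.Definitions using (tri<; tri≈; tri>)

open Equivalence using (to; from)

#[_] : ∀ {n} {P : Fin n → Set} → (∀ i → Dec (P i)) → ℕ
#[ P? ] = count (λ i → does (P? i))

𝟙 : ∀ {A : Set} → Dec A → ℕ
𝟙 d = if does d then 1 else 0

count-cong : ∀ {n} {p q : Fin n → Bool} → (∀ i → p i ≡ q i) → count p ≡ count q
count-cong {zero}  _   = refl
count-cong {suc n} p≗q = cong₂ _+_ (cong (λ b → if b then 1 else 0) (p≗q zero)) (count-cong (p≗q ∘ suc))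

count≤n : ∀ {n} (p : Fin n → Bool) → count p ≤ n
count≤n {zero}  p = z≤n
count≤n {suc n} p with p zero
... | true  = s≤s (count≤n (p ∘ suc))
... | false = m≤n⇒m≤1+n (count≤n (p ∘ suc))

count≡∑ : ∀ {n} (p : Fin n → Bool) → count p ≡ ∑[ i < n ] (if p i then 1 else 0)
count≡∑ {zero}  p = refl
count≡∑ {suc n} p = cong ((if p zero then 1 else 0) +_) (count≡∑ (p ∘ suc))

𝟙-mono : ∀ {A B : Set} (a? : Dec A) (b? : Dec B) → (A → B) → 𝟙 a? ≤ 𝟙 b?
𝟙-mono (no _)  _       _   = z≤n
𝟙-mono (yes a) (yes _) _   = ≤-refl
𝟙-mono (yes a) (no ¬b) A⇒B = ⊥-elim (¬b (A⇒B a))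

𝟙-⊎ : ∀ {A B : Set} (a? : Dec A) (b? : Dec B) → (A → ¬ B) → 𝟙 (a? ⊎-dec b?) ≡ 𝟙 a? + 𝟙 b?
𝟙-⊎ (yes a) (yes b) disjoint = ⊥-elim (disjoint a b)
𝟙-⊎ (yes _) (no _)  _        = refl
𝟙-⊎ (no _)  (yes _) _        = refl
𝟙-⊎ (no _)  (no _)  _        = refl

#-cong : ∀ {n} {P Q : Fin n → Set} (P? : ∀ i → Dec (P i)) (Q? : ∀ i → Dec (Q i)) →
         (∀ i → P i ⇔ Q i) → #[ P? ] ≡ #[ Q? ]
#-cong P? Q? P⇔Q = count-cong (λ i → does-⇔ (P⇔Q i) (P? i) (Q? i))

#-mono : ∀ {n} {P Q : Fin n → Set} (P? : ∀ i → Dec (P i)) (Q? : ∀ i → Dec (Q i)) →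
         (∀ i → P i → Q i) → #[ P? ] ≤ #[ Q? ]
#-mono {zero}  P? Q? P⊆Q = z≤n
#-mono {suc n} P? Q? P⊆Q = +-mono-≤ (𝟙-mono (P? zero) (Q? zero) (P⊆Q zero)) (#-mono (P? ∘ suc) (Q? ∘ suc) (P⊆Q ∘ suc))

#-⊎ : ∀ {n} {P Q : Fin n → Set} (P? : ∀ i → Dec (P i)) (Q? : ∀ i → Dec (Q i)) →
      (∀ i → P i → ¬ Q i) → #[ (λ i → P? i ⊎-dec Q? i) ] ≡ #[ P? ] + #[ Q? ]
#-⊎ {zero}  P? Q? disjoint = refl
#-⊎ {suc n} P? Q? disjoint = begin
  𝟙 (P? zero ⊎-dec Q? zero) + #[ (λ i → P? (suc i) ⊎-dec Q? (suc i)) ]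
    ≡⟨ cong₂ _+_ (𝟙-⊎ (P? zero) (Q? zero) (disjoint zero)) (#-⊎ (P? ∘ suc) (Q? ∘ suc) (disjoint ∘ suc)) ⟩
  (𝟙 (P? zero) + 𝟙 (Q? zero)) + (#[ P? ∘ suc ] + #[ Q? ∘ suc ])
    ≡⟨ interchange (𝟙 (P? zero)) (𝟙 (Q? zero)) _ _ ⟩
  #[ P? ] + #[ Q? ] ∎
  where open ≡-Reasoning

#-none : ∀ {n} {P : Fin n → Set} (P? : ∀ i → Dec (P i)) → (∀ i → ¬ P i) → #[ P? ] ≡ 0
#-none {zero}  P? ¬P = refl
#-none {suc n} P? ¬P rewrite dec-false (P? zero) (¬P zero) = #-none (P? ∘ suc) (¬P ∘ suc)

#-all : ∀ {n} {P : Fin n → Set} (P? : ∀ i → Dec (P i)) → (∀ i → P i) → #[ P? ] ≡ n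
#-all {zero}  P? allP = refl
#-all {suc n} P? allP rewrite dec-true (P? zero) (allP zero) = cong suc (#-all (P? ∘ suc) (allP ∘ suc))

#-≡ : ∀ {n} (x : Fin n) → #[ (λ i → i Fin.≟ x) ] ≡ 1
#-≡ {suc n} zero = cong suc (#-none {n} (λ i → suc i Fin.≟ zero) (λ i ()))
#-≡ {suc n} (suc x) = trans (#-cong (λ i → suc i Fin.≟ suc x) (λ i → i Fin.≟ x) (λ i → mk⇔ Finₚ.suc-injective (cong suc))) (#-≡ x)

#-unique : ∀ {n} {P : Fin n → Set} (P? : ∀ i → Dec (P i)) (x : Fin n) →
           P x → (∀ i → P i → i ≡ x) → #[ P? ] ≡ 1
#-unique P? x Px unique = trans (#-cong P? (λ i → i Fin.≟ x) (λ i → mk⇔ (unique i) (λ { refl → Px }))) (#-≡ x)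

#-< : ∀ {n} {P Q : Fin n → Set} (P? : ∀ i → Dec (P i)) (Q? : ∀ i → Dec (Q i)) (x : Fin n) →
      (∀ i → P i → Q i) → ¬ P x → Q x → #[ P? ] < #[ Q? ]
#-< P? Q? x P⊆Q ¬Px Qx = begin-strict
  #[ P? ]                                       <⟨ n<1+n _ ⟩
  suc #[ P? ]                                   ≡⟨ cong (_+ #[ P? ]) (#-≡ x) ⟨
  #[ (λ i → i Fin.≟ x) ] + #[ P? ]              ≡⟨ #-⊎ (λ i → i Fin.≟ x) P? (λ { i refl → ¬Px }) ⟨
  #[ (λ i → (i Fin.≟ x) ⊎-dec P? i) ]           ≤⟨ #-mono (λ i → (i Fin.≟ x) ⊎-dec P? i) Q? (λ { i (inj₁ refl) → Qx ; i (inj₂ Pi) → P⊆Q i Pi }) ⟩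
  #[ Q? ]                                       ∎
  where open ≤-Reasoning

#-∁ : ∀ {n} {P : Fin n → Set} (P? : ∀ i → Dec (P i)) → #[ P? ] + #[ (λ i → ¬? (P? i)) ] ≡ n
#-∁ {P = P} P? = trans (sym (#-⊎ P? (λ i → ¬? (P? i)) (λ i Pi ¬Pi → ¬Pi Pi))) (#-all (λ i → P? i ⊎-dec ¬? (P? i)) excluded-middle)
  where
  excluded-middle : ∀ i → P i ⊎ ¬ P i
  excluded-middle i with P? i
  ... | yes Pi = inj₁ Pi
  ... | no ¬Pi = inj₂ ¬Pi

#-permute : ∀ {n} {P : Fin n → Set} (P? : ∀ i → Dec (P i)) (π : Permutation′ n) →
            #[ (λ i → P? (π ⟨$⟩ˡ i)) ] ≡ #[ P? ]
#-permute P? π = begin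
  #[ (λ i → P? (π ⟨$⟩ˡ i)) ]          ≡⟨ count≡∑ (λ i → does (P? (π ⟨$⟩ˡ i))) ⟩
  sum (λ i → 𝟙 (P? (π ⟨$⟩ˡ i)))       ≡⟨ sum-permute (𝟙 ∘ P?) (flip π) ⟨
  sum (𝟙 ∘ P?)                        ≡⟨ count≡∑ (does ∘ P?) ⟨
  #[ P? ]                             ∎
  where open ≡-Reasoning

∑-const : ∀ n c → ∑[ i < n ] c ≡ n * c
∑-const zero    c = refl
∑-const (suc n) c = cong (c +_) (∑-const n c)

∑-mono-≤ : ∀ {n} {f g : Fin n → ℕ} → (∀ i → f i ≤ g i) → sum f ≤ sum g
∑-mono-≤ {zero}  f≤g = z≤n
∑-mono-≤ {suc n} f≤g = +-mono-≤ (f≤g zero) (∑-mono-≤ (f≤g ∘ suc))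

∑-↑ : ∀ a {b} (f : Fin (a + b) → ℕ) → sum f ≡ ∑[ i < a ] f (i ↑ˡ b) + ∑[ j < b ] f (a ↑ʳ j)
∑-↑ zero    f = refl
∑-↑ (suc a) f = trans (cong (f zero +_) (∑-↑ a (f ∘ suc))) (sym (+-assoc (f zero) _ _))

∑-combine : ∀ a b (f : Fin (a * b) → ℕ) → sum f ≡ ∑[ i < a ] ∑[ j < b ] f (combine i j)
∑-combine zero    b f = refl
∑-combine (suc a) b f = trans (∑-↑ b f) (cong (∑[ j < b ] f (j ↑ˡ (a * b)) +_) (∑-combine a b (f ∘ (b ↑ʳ_))))

#-combine : ∀ a b {P : Fin a → Fin b → Set} (P? : ∀ i j → Dec (P i j)) →
            #[ (λ y → P? (quotient b y) (remainder {a} b y)) ] ≡ ∑[ i < a ] #[ P? i ]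
#-combine a b P? = begin
  #[ (λ y → P? (quotient b y) (remainder {a} b y)) ]
    ≡⟨ count≡∑ (λ y → does (P? (quotient b y) (remainder {a} b y))) ⟩
  sum (λ y → 𝟙 (P? (quotient b y) (remainder {a} b y)))
    ≡⟨ ∑-combine a b _ ⟩
  ∑[ i < a ] ∑[ j < b ] 𝟙 (P? (quotient b (combine i j)) (remainder {a} b (combine i j)))
    ≡⟨ sum-cong-≗ (λ i → sum-cong-≗ (λ j → cong (λ ij → 𝟙 (P? (proj₁ ij) (proj₂ ij))) (Finₚ.remQuot-combine i j))) ⟩
  ∑[ i < a ] ∑[ j < b ] 𝟙 (P? i j)
    ≡⟨ sum-cong-≗ (λ i → count≡∑ (does ∘ P? i)) ⟨
  ∑[ i < a ] #[ P? i ]  ∎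
  where open ≡-Reasoning

#-const : ∀ t {A : Set} (a? : Dec A) → #[ (λ (_ : Fin t) → a?) ] ≡ t * 𝟙 a?
#-const t a? = trans (count≡∑ {t} (λ _ → does a?)) (∑-const t (𝟙 a?))

#-blowup : ∀ a t {P : Fin a → Set} (P? : ∀ i → Dec (P i)) →
           #[ (λ y → P? (quotient {a} t y)) ] ≡ t * #[ P? ]
#-blowup a t P? = begin
  #[ (λ y → P? (quotient {a} t y)) ]   ≡⟨ #-combine a t (λ i _ → P? i) ⟩
  ∑[ i < a ] #[ (λ (_ : Fin t) → P? i) ] ≡⟨ sum-cong-≗ (λ i → #-const t (P? i)) ⟩
  ∑[ i < a ] (t * 𝟙 (P? i))            ≡⟨ *-distribˡ-sum t (𝟙 ∘ P?) ⟨
  t * sum (𝟙 ∘ P?)                      ≡⟨ cong (t *_) (count≡∑ (does ∘ P?)) ⟨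
  t * #[ P? ]                           ∎
  where open ≡-Reasoning

∑-#-comm : ∀ {a b} {R : Fin a → Fin b → Set} (R? : ∀ i j → Dec (R i j)) →
           ∑[ i < a ] #[ R? i ] ≡ ∑[ j < b ] #[ (λ i → R? i j) ]
∑-#-comm {a} {b} R? = begin
  ∑[ i < a ] #[ R? i ]                   ≡⟨ sum-cong-≗ (λ i → count≡∑ (does ∘ R? i)) ⟩
  ∑[ i < a ] ∑[ j < b ] 𝟙 (R? i j)       ≡⟨ ∑-comm (λ i j → 𝟙 (R? i j)) ⟩
  ∑[ j < b ] ∑[ i < a ] 𝟙 (R? i j)       ≡⟨ sum-cong-≗ (λ j → count≡∑ (λ i → does (R? i j))) ⟨
  ∑[ j < b ] #[ (λ i → R? i j) ]         ∎
  where open ≡-Reasoning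

∑-#-fibres : ∀ {n k} (f : Fin n → Fin k) → ∑[ c < k ] #[ (λ x → f x Fin.≟ c) ] ≡ n
∑-#-fibres {n} {k} f = begin
  ∑[ c < k ] #[ (λ x → f x Fin.≟ c) ]    ≡⟨ ∑-#-comm (λ c x → f x Fin.≟ c) ⟩
  ∑[ x < n ] #[ (λ c → f x Fin.≟ c) ]    ≡⟨ sum-cong-≗ (λ x → #-unique (λ c → f x Fin.≟ c) (f x) refl (λ c → sym)) ⟩
  ∑[ x < n ] 1                           ≡⟨ ∑-const n 1 ⟩
  n * 1                                  ≡⟨ *-identityʳ n ⟩
  n                                      ∎
  where open ≡-Reasoning

injective⇒surjective : ∀ {m n} {f : Fin m → Fin n} → Injective _≡_ _≡_ f → n ≤ m → ∀ y → ∃ λ x → f x ≡ y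
injective⇒surjective {m} {suc n} {f} f-inj n≤m y with Finₚ.any? (λ x → f x Fin.≟ y)
... | yes hit = hit
... | no  miss = ⊥-elim (<-irrefl refl (≤-trans n≤m (Finₚ.injective⇒≤ f′-inj)))
  where
  y≢f : ∀ x → y ≢ f x
  y≢f x y≡fx = miss (x , sym y≡fx)
  f′-inj : Injective _≡_ _≡_ (λ x → punchOut (y≢f x))
  f′-inj e = f-inj (Finₚ.punchOut-injective (y≢f _) (y≢f _) e)

surjective⇒≤ : ∀ {m n} (f : Fin m → Fin n) → (∀ y → ∃ λ x → f x ≡ y) → n ≤ m
surjective⇒≤ f surj = Finₚ.injective⇒≤ section-inj
  where
  section-inj : Injective _≡_ _≡_ (proj₁ ∘ surj)
  section-inj {y} {y′} e = trans (sym (proj₂ (surj y))) (trans (cong f e) (proj₂ (surj y′)))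

permutation-injective : ∀ {n} (π : Permutation′ n) → Injective _≡_ _≡_ (π ⟨$⟩ʳ_)
permutation-injective π e = trans (sym (inverseˡ π)) (trans (cong (π ⟨$⟩ˡ_) e) (inverseˡ π))

injective⇒permutation : ∀ {n} (f : Fin n → Fin n) → Injective _≡_ _≡_ f →
                        ∃ λ (π : Permutation′ n) → ∀ i → π ⟨$⟩ʳ i ≡ f i
injective⇒permutation f f-inj = permutation f f⁻¹ (proj₂ ∘ onto) (λ x → f-inj (proj₂ (onto (f x)))) , λ _ → refl
  where
  onto : ∀ y → ∃ λ x → f x ≡ y
  onto = injective⇒surjective f-inj ≤-refl
  f⁻¹ : Fin _ → Fin _
  f⁻¹ = proj₁ ∘ onto

#-downset : ∀ {n} {P : Fin n → Set} (P? : ∀ i → Dec (P i)) →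
            (∀ {i j} → toℕ i ≤ toℕ j → P j → P i) → ∀ y → P y ⇔ toℕ y < #[ P? ]
#-downset {suc n} {P} P? closed y with P? zero
... | yes P0 = mk⇔ (forth y) (back y)
  where
  tail : ∀ y → P (suc y) ⇔ toℕ y < #[ P? ∘ suc ]
  tail = #-downset (P? ∘ suc) (λ i≤j → closed (s≤s i≤j))
  forth : ∀ y → P y → toℕ y < suc #[ P? ∘ suc ]
  forth zero    _   = s≤s z≤n
  forth (suc y) Psy = s≤s (to (tail y) Psy)
  back : ∀ y → toℕ y < suc #[ P? ∘ suc ] → P y
  back zero    _         = P0
  back (suc y) (s≤s y<#) = from (tail y) y<#
... | no ¬P0 = mk⇔ (λ Py → ⊥-elim (¬P0 (closed z≤n Py))) (λ y<# → ⊥-elim (n≮0 (subst (toℕ y <_) empty y<#)))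
  where
  empty : #[ P? ∘ suc ] ≡ 0
  empty = #-none (P? ∘ suc) (λ i Pi → ¬P0 (closed z≤n Pi))

-- For a monotone m, level v (the vertices p with m p ≡ v) is the interval [below v, below v + width v)
-- and depth p is the position of p inside its level.
module Blocks {n : ℕ} (m : Fin n → ℕ) (m-mono : ∀ p q → toℕ p ≤ toℕ q → m p ≤ m q) where

  below : ℕ → ℕ
  below v = #[ (λ y → m y <? v) ]

  width : ℕ → ℕ
  width v = #[ (λ y → m y ≟ v) ]

  below-spec : ∀ v y → m y < v ⇔ toℕ y < below v
  below-spec v = #-downset (λ y → m y <? v) (λ {i} {j} i≤j mj<v → ≤-<-trans (m-mono i j i≤j) mj<v)

  below-suc : ∀ v → below (suc v) ≡ below v + width v
  below-suc v = trans (#-cong (λ y → m y <? suc v) (λ y → (m y <? v) ⊎-dec (m y ≟ v)) (λ y → mk⇔ m<1+n⇒m<n∨m≡n <⊎≡⇒<1+))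
                      (#-⊎ (λ y → m y <? v) (λ y → m y ≟ v) (λ y → <⇒≢))
    where
    <⊎≡⇒<1+ : ∀ {x} → x < v ⊎ x ≡ v → x < suc v
    <⊎≡⇒<1+ (inj₁ x<v)  = m<n⇒m<1+n x<v
    <⊎≡⇒<1+ (inj₂ refl) = n<1+n v

  below-≤-position : ∀ p → below (m p) ≤ toℕ p
  below-≤-position p = ≮⇒≥ (λ p<below → <-irrefl refl (from (below-spec (m p) p) p<below))

  position-<-block-end : ∀ p → toℕ p < below (m p) + width (m p)
  position-<-block-end p = subst (toℕ p <_) (below-suc (m p)) (to (below-spec (suc (m p)) p) ≤-refl)

  level-of-position : ∀ v p → below v ≤ toℕ p → toℕ p < below v + width v → m p ≡ v
  level-of-position v p start≤p p<end = ≤-antisym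
    (s≤s⁻¹ (from (below-spec (suc v) p) (subst (toℕ p <_) (sym (below-suc v)) p<end)))
    (≮⇒≥ (λ mp<v → <-irrefl refl (<-≤-trans (to (below-spec v p) mp<v) start≤p)))

  block-end-≤-below : ∀ {v w} → v < w → below v + width v ≤ below w
  block-end-≤-below {v} {w} v<w = subst (_≤ below w) (below-suc v)
    (#-mono (λ y → m y <? suc v) (λ y → m y <? w) (λ y my<1+v → <-≤-trans my<1+v v<w))

  block-end-≤-n : ∀ v → below v + width v ≤ n
  block-end-≤-n v = subst (_≤ n) (below-suc v) (count≤n _)

  depth : Fin n → ℕ
  depth p = toℕ p ∸ below (m p)

  depth<width : ∀ p → depth p < width (m p)
  depth<width p = subst (depth p <_) (m+n∸m≡n (below (m p)) (width (m p)))
    (∸-monoˡ-< (position-<-block-end p) (below-≤-position p))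

  at : ∀ v d → d < width v → Fin n
  at v d d<w = Fin.fromℕ< (<-≤-trans (+-monoʳ-< (below v) d<w) (block-end-≤-n v))

  toℕ-at : ∀ v d d<w → toℕ (at v d d<w) ≡ below v + d
  toℕ-at v d d<w = Finₚ.toℕ-fromℕ< _

  level-at : ∀ v d d<w → m (at v d d<w) ≡ v
  level-at v d d<w = level-of-position v (at v d d<w)
    (subst (below v ≤_) (sym (toℕ-at v d d<w)) (m≤m+n (below v) d))
    (subst (_< below v + width v) (sym (toℕ-at v d d<w)) (+-monoʳ-< (below v) d<w))

  depth-at : ∀ v d d<w → depth (at v d d<w) ≡ d
  depth-at v d d<w rewrite level-at v d d<w | toℕ-at v d d<w = m+n∸m≡n (below v) d

  at-mono : ∀ {v w d e} (d<v : d < width v) (e<w : e < width w) →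
            v < w ⊎ (v ≡ w × d < e) → toℕ (at v d d<v) < toℕ (at w e e<w)
  at-mono {v} {w} {d} {e} d<v e<w (inj₁ v<w) rewrite toℕ-at v d d<v | toℕ-at w e e<w =
    <-≤-trans (+-monoʳ-< (below v) d<v) (≤-trans (block-end-≤-below v<w) (m≤m+n (below w) e))
  at-mono {v} {d = d} {e} d<v e<w (inj₂ (refl , d<e)) rewrite toℕ-at v d d<v | toℕ-at v e e<w =
    +-monoʳ-< (below v) d<e

  position-lex : ∀ p q → toℕ p < toℕ q → m p < m q ⊎ (m p ≡ m q × depth p < depth q)
  position-lex p q p<q with m<1+n⇒m<n∨m≡n (s≤s (m-mono p q (<⇒≤ p<q)))
  ... | inj₁ mp<mq = inj₁ mp<mq
  ... | inj₂ mp≡mq = inj₂ (mp≡mq , subst (λ v → depth p < toℕ q ∸ below v) mp≡mq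
                                    (∸-monoˡ-< p<q (below-≤-position p)))

module Ranking {n : ℕ} (key : Fin n → ℕ) where

  _≺_ : Fin n → Fin n → Set
  x ≺ y = key x < key y ⊎ (key x ≡ key y × x Fin.< y)

  _≺?_ : ∀ x y → Dec (x ≺ y)
  x ≺? y = (key x <? key y) ⊎-dec ((key x ≟ key y) ×-dec (x Fin.<? y))

  ≺-irrefl : ∀ x → ¬ x ≺ x
  ≺-irrefl x (inj₁ kx<kx)      = <-irrefl refl kx<kx
  ≺-irrefl x (inj₂ (_ , x<x)) = Finₚ.<-irrefl refl x<x

  ≺-trans : ∀ {x y z} → x ≺ y → y ≺ z → x ≺ z
  ≺-trans (inj₁ a)          (inj₁ b)          = inj₁ (<-trans a b)
  ≺-trans (inj₁ a)          (inj₂ (b , _))    = inj₁ (<-≤-trans a (≤-reflexive b))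
  ≺-trans (inj₂ (a , _))    (inj₁ b)          = inj₁ (≤-<-trans (≤-reflexive a) b)
  ≺-trans (inj₂ (a , x<y))  (inj₂ (b , y<z))  = inj₂ (trans a b , Finₚ.<-trans x<y y<z)

  ≺-connex : ∀ x y → x ≢ y → x ≺ y ⊎ y ≺ x
  ≺-connex x y x≢y with <-cmp (key x) (key y)
  ... | tri< kx<ky _ _ = inj₁ (inj₁ kx<ky)
  ... | tri> _ _ ky<kx = inj₂ (inj₁ ky<kx)
  ... | tri≈ _ kx≡ky _ with Finₚ.<-cmp x y
  ...   | tri< x<y _ _ = inj₁ (inj₂ (kx≡ky , x<y))
  ...   | tri≈ _ x≡y _ = ⊥-elim (x≢y x≡y)
  ...   | tri> _ _ y<x = inj₂ (inj₂ (sym kx≡ky , y<x))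

  rank : Fin n → ℕ
  rank x = #[ (λ i → i ≺? x) ]

  rank-mono : ∀ {x y} → x ≺ y → rank x < rank y
  rank-mono {x} {y} x≺y = #-< (λ i → i ≺? x) (λ i → i ≺? y) x (λ i i≺x → ≺-trans i≺x x≺y) (≺-irrefl x) x≺y

  rank<n : ∀ x → rank x < n
  rank<n x = subst (rank x <_) (#-all (λ _ → yes tt) (λ _ → tt))
    (#-< (λ i → i ≺? x) (λ (_ : Fin n) → yes tt) x (λ _ _ → tt) (≺-irrefl x) tt)

  rank-injective : ∀ {x y} → rank x ≡ rank y → x ≡ y
  rank-injective {x} {y} rx≡ry with x Fin.≟ y
  ... | yes x≡y = x≡y
  ... | no  x≢y with ≺-connex x y x≢y
  ...   | inj₁ x≺y = ⊥-elim (<-irrefl rx≡ry (rank-mono x≺y))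
  ...   | inj₂ y≺x = ⊥-elim (<-irrefl (sym rx≡ry) (rank-mono y≺x))

  rankᶠ : Fin n → Fin n
  rankᶠ x = Fin.fromℕ< (rank<n x)

  toℕ-rankᶠ : ∀ x → toℕ (rankᶠ x) ≡ rank x
  toℕ-rankᶠ x = Finₚ.toℕ-fromℕ< (rank<n x)

  ranking : Permutation′ n
  ranking = proj₁ (injective⇒permutation rankᶠ
    (λ {x} {y} e → rank-injective (trans (sym (toℕ-rankᶠ x)) (trans (cong toℕ e) (toℕ-rankᶠ y)))))

  ranking-mono : ∀ x y → key x < key y → ranking ⟨$⟩ʳ x Fin.< ranking ⟨$⟩ʳ y
  ranking-mono x y kx<ky = subst₂ _<_ (sym (toℕ-rankᶠ x)) (sym (toℕ-rankᶠ y)) (rank-mono (inj₁ kx<ky))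

  ranking-reflects : ∀ x y → ranking ⟨$⟩ʳ x Fin.< ranking ⟨$⟩ʳ y → key x ≤ key y
  ranking-reflects x y ρx<ρy = ≮⇒≥ (λ ky<kx → Finₚ.<-asym ρx<ρy (ranking-mono y x ky<kx))

  key-mono-ranking⁻¹ : ∀ a b → toℕ a ≤ toℕ b → key (ranking ⟨$⟩ˡ a) ≤ key (ranking ⟨$⟩ˡ b)
  key-mono-ranking⁻¹ a b a≤b = ≮⇒≥ (λ kb<ka → <-irrefl refl (≤-<-trans a≤b
    (subst₂ Fin._<_ (inverseʳ ranking) (inverseʳ ranking) (ranking-mono _ _ kb<ka))))

StrictlyMonotone : ∀ {m n} → (Fin m → Fin n) → Set
StrictlyMonotone f = ∀ a b → a Fin.< b → f a Fin.< f b

strictlyMonotone⇒injective : ∀ {m n} {f : Fin m → Fin n} → StrictlyMonotone f → Injective _≡_ _≡_ f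
strictlyMonotone⇒injective mono {a} {b} fa≡fb with Finₚ.<-cmp a b
... | tri< a<b _ _ = ⊥-elim (Finₚ.<-irrefl fa≡fb (mono a b a<b))
... | tri≈ _ a≡b _ = a≡b
... | tri> _ _ b<a = ⊥-elim (Finₚ.<-irrefl (sym fa≡fb) (mono b a b<a))

module _ {H G : OrderedGraph} where

  emb-injective : (T : Tiling H G) (j : Fin (copies T)) → Injective _≡_ _≡_ (emb T j)
  emb-injective T j = strictlyMonotone⇒injective (proj₁ (isEmb T j))

  Within : Tiling H G → (Fin (size G) → Set) → Set
  Within T P = ∀ j a → P (emb T j a)

  emptyTiling : Tiling H G
  emptyTiling = record { copies = 0 ; emb = λ () ; isEmb = λ () ; disjoint = λ () }

  cells : (T : Tiling H G) → Fin (covered T) → Fin (size G)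
  cells T y = emb T (quotient {copies T} (size H) y) (remainder {copies T} (size H) y)

  cells-injective : (T : Tiling H G) → Injective _≡_ _≡_ (cells T)
  cells-injective T {y} {y′} e = begin
    y                                                ≡⟨ Finₚ.combine-remQuot {copies T} (size H) y ⟨
    combine (quotient {copies T} (size H) y) (remainder {copies T} (size H) y)
      ≡⟨ cong₂ combine same-copy (emb-injective T _ (subst (λ j → emb T j r ≡ cells T y′) same-copy e)) ⟩
    combine (quotient {copies T} (size H) y′) (remainder {copies T} (size H) y′)
                                                     ≡⟨ Finₚ.combine-remQuot {copies T} (size H) y′ ⟩
    y′                                               ∎
    where
    open ≡-Reasoning
    r : Fin (size H)
    r = remainder {copies T} (size H) y
    same-copy : quotient {copies T} (size H) y ≡ quotient {copies T} (size H) y′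
    same-copy = disjoint T _ _ r _ e

  perfect⇒size≤covered : (T : Tiling H G) → (∀ v → ∃ λ j → ∃ λ a → emb T j a ≡ v) → size G ≤ covered T
  perfect⇒size≤covered T onto = surjective⇒≤ (cells T) λ v →
    let (j , a , e) = onto v in
    combine j a , trans (cong (λ (j , a) → emb T j a) (Finₚ.remQuot-combine j a)) e

  size≤covered⇒perfect : (T : Tiling H G) → size G ≤ covered T → ∀ v → ∃ λ j → ∃ λ a → emb T j a ≡ v
  size≤covered⇒perfect T size≤ v =
    let (y , e) = injective⇒surjective (cells-injective T) size≤ v in
    quotient {copies T} (size H) y , remainder {copies T} (size H) y , e

isEmbedding-∘ : ∀ {H G G′} {f : Fin (size G) → Fin (size G′)} {g : Fin (size H) → Fin (size G)} →
                IsEmbedding G G′ f → IsEmbedding H G g → IsEmbedding H G′ (f ∘ g)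
isEmbedding-∘ (f-mono , f-edge) (g-mono , g-edge) =
  (λ a b a<b → f-mono _ _ (g-mono a b a<b)) , (λ a b ab → f-edge _ _ (g-edge a b ab))

mapTiling : ∀ {H G G′} (f : Fin (size G) → Fin (size G′)) → IsEmbedding G G′ f → Tiling H G → Tiling H G′
mapTiling {H} {G} {G′} f f-emb T = record
  { copies   = copies T
  ; emb      = λ j → f ∘ emb T j
  ; isEmb    = λ j → isEmbedding-∘ {H} {G} {G′} f-emb (isEmb T j)
  ; disjoint = λ j j′ a b e → disjoint T j j′ a b (strictlyMonotone⇒injective (proj₁ f-emb) e) }

module Union {H G : OrderedGraph} (T₁ T₂ : Tiling H G) (apart : ∀ j a j′ b → emb T₁ j a ≢ emb T₂ j′ b) where

  private
    pick : Fin (copies T₁) ⊎ Fin (copies T₂) → Fin (size H) → Fin (size G)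
    pick = [ emb T₁ , emb T₂ ]′

    pick-isEmb : ∀ s → IsEmbedding H G (pick s)
    pick-isEmb (inj₁ j) = isEmb T₁ j
    pick-isEmb (inj₂ j) = isEmb T₂ j

    pick-injective : ∀ s s′ a b → pick s a ≡ pick s′ b → s ≡ s′
    pick-injective (inj₁ j) (inj₁ j′) a b e = cong inj₁ (disjoint T₁ j j′ a b e)
    pick-injective (inj₂ j) (inj₂ j′) a b e = cong inj₂ (disjoint T₂ j j′ a b e)
    pick-injective (inj₁ j) (inj₂ j′) a b e = ⊥-elim (apart j a j′ b e)
    pick-injective (inj₂ j) (inj₁ j′) a b e = ⊥-elim (apart j′ b j a (sym e))

  union : Tiling H G
  union = record
    { copies   = copies T₁ + copies T₂
    ; emb      = pick ∘ splitAt (copies T₁)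
    ; isEmb    = pick-isEmb ∘ splitAt (copies T₁)
    ; disjoint = λ j j′ a b e → begin
        j                                         ≡⟨ Finₚ.join-splitAt (copies T₁) (copies T₂) j ⟨
        join _ _ (splitAt (copies T₁) j)          ≡⟨ cong (join _ _) (pick-injective (splitAt (copies T₁) j) (splitAt (copies T₁) j′) a b e) ⟩
        join _ _ (splitAt (copies T₁) j′)         ≡⟨ Finₚ.join-splitAt (copies T₁) (copies T₂) j′ ⟩
        j′                                        ∎ }
    where open ≡-Reasoning

  covered-union : covered union ≡ covered T₁ + covered T₂
  covered-union = *-distribʳ-+ (size H) (copies T₁) (copies T₂)

  within-union : ∀ {P} → Within T₁ P → Within T₂ P → Within union P
  within-union {P} in₁ in₂ j = pick-within (splitAt (copies T₁) j)
    where
    pick-within : ∀ s a → P (pick s a)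
    pick-within (inj₁ j) = in₁ j
    pick-within (inj₂ j) = in₂ j

module _ (B : Multipartite) (φ : Permutation′ (N B)) (t u : ℕ) where

  -- the i-th copy of B(t) inside B(t u): position s of a block goes to position s u + i
  blowupCopy : Fin u → Fin (N B * t) → Fin (N B * (t * u))
  blowupCopy i p = combine (quotient {N B} t p) (combine (remainder {N B} t p) i)

  toℕ-blowupCopy : ∀ i p → toℕ (blowupCopy i p) ≡ toℕ (combine {N B * t} {u} p i)
  toℕ-blowupCopy i p = begin
    toℕ (blowupCopy i p)                        ≡⟨ Finₚ.toℕ-combine x (combine s i) ⟩
    t * u * toℕ x + toℕ (combine s i)           ≡⟨ cong (t * u * toℕ x +_) (Finₚ.toℕ-combine s i) ⟩
    t * u * toℕ x + (u * toℕ s + toℕ i)         ≡⟨ regroup t u (toℕ x) (toℕ s) (toℕ i) ⟩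
    u * (t * toℕ x + toℕ s) + toℕ i             ≡⟨ cong (λ z → u * z + toℕ i) (Finₚ.toℕ-combine x s) ⟨
    u * toℕ (combine x s) + toℕ i               ≡⟨ cong (λ z → u * toℕ z + toℕ i) (Finₚ.combine-remQuot {N B} t p) ⟩
    u * toℕ p + toℕ i                           ≡⟨ Finₚ.toℕ-combine p i ⟨
    toℕ (combine p i)                           ∎
    where
    open ≡-Reasoning
    x = quotient {N B} t p
    s = remainder {N B} t p
    regroup : ∀ t u x s i → t * u * x + (u * s + i) ≡ u * (t * x + s) + i
    regroup = solve-∀

  blowupCopy-injective : ∀ {i i′ p p′} → blowupCopy i p ≡ blowupCopy i′ p′ → i ≡ i′ × p ≡ p′
  blowupCopy-injective {i} {i′} {p} {p′} e = let combine≡ = Finₚ.toℕ-injective (trans (sym (toℕ-blowupCopy i p)) (trans (cong toℕ e) (toℕ-blowupCopy i′ p′))) in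
    Finₚ.combine-injectiveʳ p i p′ i′ combine≡ , Finₚ.combine-injectiveˡ p i p′ i′ combine≡

  blowupCopy-isEmbedding : ∀ i → IsEmbedding (orderedBlowup B φ t) (orderedBlowup B φ (t * u)) (blowupCopy i)
  blowupCopy-isEmbedding i = mono , edge
    where
    mono : ∀ p q → p Fin.< q → blowupCopy i p Fin.< blowupCopy i q
    mono p q p<q = subst₂ _<_ (sym (toℕ-blowupCopy i p)) (sym (toℕ-blowupCopy i q)) (Finₚ.combine-monoˡ-< i i p<q)
    block : ∀ p → quotient {N B} (t * u) (blowupCopy i p) ≡ quotient t p
    block p = cong proj₁ (Finₚ.remQuot-combine (quotient {N B} t p) (combine (remainder {N B} t p) i))
    edge : ∀ p q → blowupEdge B φ t p q → blowupEdge B φ (t * u) (blowupCopy i p) (blowupCopy i q)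
    edge p q pq rewrite block p | block q = pq

  perfectTiling-blowup-* : ∀ {H} → PerfectTiling H (orderedBlowup B φ t) → PerfectTiling H (orderedBlowup B φ (t * u))
  perfectTiling-blowup-* {H} (T , onto) = T′ , size≤covered⇒perfect T′ (begin
    N B * (t * u)                 ≡⟨ *-assoc (N B) t u ⟨
    N B * t * u                   ≤⟨ *-monoˡ-≤ u (perfect⇒size≤covered T onto) ⟩
    copies T * size H * u         ≡⟨ regroup (copies T) (size H) u ⟩
    u * copies T * size H         ∎)
    where
    open ≤-Reasoning
    copyOf : Fin (u * copies T) → Fin u
    copyOf = quotient {u} (copies T)
    tileOf : Fin (u * copies T) → Fin (copies T)
    tileOf = remainder {u} (copies T)
    regroup : ∀ c h u → c * h * u ≡ u * c * h
    regroup = solve-∀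
    T′ : Tiling H (orderedBlowup B φ (t * u))
    T′ = record
      { copies   = u * copies T
      ; emb      = λ k → blowupCopy (copyOf k) ∘ emb T (tileOf k)
      ; isEmb    = λ k → isEmbedding-∘ {H} {orderedBlowup B φ t} {orderedBlowup B φ (t * u)} (blowupCopy-isEmbedding (copyOf k)) (isEmb T (tileOf k))
      ; disjoint = λ k k′ a b e → let (i≡ , p≡) = blowupCopy-injective e in
          trans (sym (Finₚ.combine-remQuot {u} (copies T) k))
            (trans (cong₂ combine i≡ (disjoint T _ _ a b p≡)) (Finₚ.combine-remQuot {u} (copies T) k′)) }

record Piece (H : OrderedGraph) : Set₁ where
  field
    graph    : OrderedGraph
    key      : Fin (size graph) → ℕ
    key-mono : ∀ p q → toℕ p ≤ toℕ q → key p ≤ key q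
    key-edge : ∀ p q → E graph p q → key p ≢ key q
    tiling   : Tiling H graph
    perfect  : size graph ≤ covered tiling

  open Blocks key key-mono public using (width; depth; depth<width; position-lex)

module Assembly {H G : OrderedGraph} (κ : Fin (size G) → ℕ) (κ-mono : ∀ p q → toℕ p ≤ toℕ q → κ p ≤ κ q)
                (κ-edge : ∀ p q → κ p ≢ κ q → E G p q) where

  open Blocks κ κ-mono

  -- P is laid out so that each of its levels v starts at depth o v inside the level v of G
  module Placement (P : Piece H) (o : ℕ → ℕ) (fits : ∀ v → o v + Piece.width P v ≤ width v) where
    private module P = Piece P

    slot<width : ∀ p → o (P.key p) + P.depth p < width (P.key p)
    slot<width p = <-≤-trans (+-monoʳ-< (o (P.key p)) (P.depth<width p)) (fits (P.key p))

    place : Fin (size P.graph) → Fin (size G)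
    place p = at (P.key p) (o (P.key p) + P.depth p) (slot<width p)

    κ-place : ∀ p → κ (place p) ≡ P.key p
    κ-place p = level-at _ _ (slot<width p)

    depth-place : ∀ p → depth (place p) ≡ o (P.key p) + P.depth p
    depth-place p = depth-at _ _ (slot<width p)

    place-isEmbedding : IsEmbedding P.graph G place
    place-isEmbedding = mono , edge
      where
      shift : ∀ p q → P.key p < P.key q ⊎ (P.key p ≡ P.key q × P.depth p < P.depth q) →
              P.key p < P.key q ⊎ (P.key p ≡ P.key q × o (P.key p) + P.depth p < o (P.key q) + P.depth q)
      shift p q (inj₁ k<k)          = inj₁ k<k
      shift p q (inj₂ (k≡k , d<d)) = inj₂ (k≡k , subst (λ v → o (P.key p) + P.depth p < o v + P.depth q) k≡k
                                                        (+-monoʳ-< (o (P.key p)) d<d))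
      mono : ∀ p q → p Fin.< q → place p Fin.< place q
      mono p q p<q = at-mono (slot<width p) (slot<width q) (shift p q (P.position-lex p q p<q))
      edge : ∀ p q → E P.graph p q → E G (place p) (place q)
      edge p q pq = κ-edge _ _ (λ κ≡ → P.key-edge p q pq (trans (sym (κ-place p)) (trans κ≡ (κ-place q))))

    placed : Tiling H G
    placed = mapTiling place place-isEmbedding P.tiling

    placed-region : Within placed (λ y → o (κ y) ≤ depth y × depth y < o (κ y) + P.width (κ y))
    placed-region j a =
      subst (λ v → o v ≤ depth (place p) × depth (place p) < o v + P.width v) (sym (κ-place p))
        (subst (λ d → o v ≤ d × d < o v + P.width v) (sym (depth-place p))
          (m≤m+n (o v) (P.depth p) , +-monoʳ-< (o v) (P.depth<width p)))
      where
      p = emb P.tiling j a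
      v = P.key p

  assemble : ∀ {K} (o : ℕ → ℕ) (ps : Fin K → Piece H) → (∀ v → o v + ∑[ j < K ] Piece.width (ps j) v ≤ width v) →
             Σ (Tiling H G) λ T → ∑[ j < K ] size (Piece.graph (ps j)) ≤ covered T × Within T (λ y → o (κ y) ≤ depth y)
  assemble {zero}  o ps fits = emptyTiling , z≤n , λ ()
  assemble {suc K} o ps fits = union , covers , within-union {λ y → o (κ y) ≤ depth y} (λ j a → proj₁ (placed-region j a)) (λ j a → ≤-trans (m≤m+n _ _) (below-rest j a))
    where
    o₊ : ℕ → ℕ
    o₊ v = o v + Piece.width (ps zero) v
    open Placement (ps zero) o (λ v → ≤-trans (+-monoʳ-≤ (o v) (m≤m+n _ _)) (fits v))
    rest : Σ (Tiling H G) λ T → ∑[ j < K ] size (Piece.graph (ps (suc j))) ≤ covered T × Within T (λ y → o₊ (κ y) ≤ depth y)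
    rest = assemble o₊ (ps ∘ suc) (λ v → subst (_≤ width v) (sym (+-assoc (o v) _ _)) (fits v))
    T₀ T₊ : Tiling H G
    T₀ = placed
    T₊ = proj₁ rest
    below-rest : Within T₊ (λ y → o₊ (κ y) ≤ depth y)
    below-rest = proj₂ (proj₂ rest)
    apart : ∀ j a j′ b → emb T₀ j a ≢ emb T₊ j′ b
    apart j a j′ b e = <-irrefl refl (<-≤-trans (subst (λ y → depth y < o₊ (κ y)) e (proj₂ (placed-region j a))) (below-rest j′ b))
    open Union T₀ T₊ apart
    covers : ∑[ j < suc K ] size (Piece.graph (ps j)) ≤ covered union
    covers = begin
      size (Piece.graph (ps zero)) + ∑[ j < K ] size (Piece.graph (ps (suc j)))
        ≤⟨ +-mono-≤ (Piece.perfect (ps zero)) (proj₁ (proj₂ rest)) ⟩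
      covered T₀ + covered T₊ ≡⟨ covered-union ⟨
      covered union ∎
      where open ≤-Reasoning

quotient-mono : ∀ {m} t (p q : Fin (m * t)) → toℕ p ≤ toℕ q → toℕ (quotient {m} t p) ≤ toℕ (quotient {m} t q)
quotient-mono {m} t p q p≤q = ≮⇒≥ λ qq<qp → <-irrefl refl (≤-<-trans p≤q
  (subst₂ (λ a b → toℕ a < toℕ b) (Finₚ.combine-remQuot {m} t q) (Finₚ.combine-remQuot {m} t p)
    (Finₚ.combine-monoˡ-< (remainder {m} t q) (remainder {m} t p) qq<qp)))

module _ (B : Multipartite) where

  private
    Proper : ∀ k → (Fin (N B) → Fin k) → Set
    Proper = ProperColouring (asGraph B)

  sameColour⇒samePart : ∀ {k} {col : Fin (N B) → Fin k} → Proper k col → ∀ u v → col u ≡ col v → part B u ≡ part B v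
  sameColour⇒samePart proper u v cu≡cv with part B u Fin.≟ part B v
  ... | yes pu≡pv = pu≡pv
  ... | no  pu≢pv = ⊥-elim (proper u v pu≢pv cu≡cv)

  -- an unused colour could be punched out, giving a proper (k - 1)-colouring
  chromatic⇒onto : ∀ {k} → IsChromaticNumber (asGraph B) k → ∀ {col} → Proper k col → ∀ c → ∃ λ x → col x ≡ c
  chromatic⇒onto {suc k} χ {col} proper c with Finₚ.any? (λ x → col x Fin.≟ c)
  ... | yes hit = hit
  ... | no miss = ⊥-elim (<-irrefl refl (proj₂ χ k (punchOut ∘ c≢col , proper′)))
    where
    c≢col : ∀ x → c ≢ col x
    c≢col x c≡ = miss (x , sym c≡)
    proper′ : Proper k (punchOut ∘ c≢col)
    proper′ u v pu≢pv e = proper u v pu≢pv (Finₚ.punchOut-injective (c≢col u) (c≢col v) e)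

  -- otherwise recolouring the class of w with the colour of u would leave the colour of w unused
  chromatic⇒samePart⇒sameColour : ∀ {k} → IsChromaticNumber (asGraph B) k → ∀ {col} → Proper k col →
                                  ∀ u w → part B u ≡ part B w → col u ≡ col w
  chromatic⇒samePart⇒sameColour χ {col} proper u w pu≡pw with col u Fin.≟ col w
  ... | yes cu≡cw = cu≡cw
  ... | no  cu≢cw = ⊥-elim (unused (proj₂ (chromatic⇒onto χ merged-proper (col w))))
    where
    merged : Fin (N B) → _
    merged x with col x Fin.≟ col w
    ... | yes _ = col u
    ... | no  _ = col x
    samePart-w : ∀ x → col x ≡ col w → part B x ≡ part B u
    samePart-w x e = trans (sameColour⇒samePart proper x w e) (sym pu≡pw)
    merged-proper : Proper _ merged
    merged-proper x y px≢py with col x Fin.≟ col w | col y Fin.≟ col w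
    ... | yes ex | yes ey = λ _ → proper x y px≢py (trans ex (sym ey))
    ... | yes ex | no  _  = λ cu≡cy → px≢py (trans (samePart-w x ex) (sameColour⇒samePart proper u y cu≡cy))
    ... | no  _  | yes ey = λ cx≡cu → px≢py (trans (sameColour⇒samePart proper x u cx≡cu) (sym (samePart-w y ey)))
    ... | no  _  | no  _  = proper x y px≢py
    unused : ∀ {x} → merged x ≢ col w
    unused {x} with col x Fin.≟ col w
    ... | yes _  = cu≢cw
    ... | no  ne = ne

  colourClass-isPart : ∀ {k} → IsChromaticNumber (asGraph B) k → ∀ {col} → Proper k col →
                       ∀ c → ∃ λ y → classSize (asGraph B) col c ≡ partSize B (part B y)
  colourClass-isPart χ {col} proper c =
    let (y , cy≡c) = chromatic⇒onto χ proper c in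
    y , #-cong (λ x → col x Fin.≟ c) (λ x → part B x Fin.≟ part B y) (λ x → mk⇔
      (λ cx≡c → sameColour⇒samePart proper x y (trans cx≡c (sym cy≡c)))
      (λ px≡py → trans (chromatic⇒samePart⇒sameColour χ proper x y px≡py) cy≡c))

ℕtoℚ≡mkℚ : ∀ n → ℕtoℚ n ≡ mkℚ (ℤ.+ n) 0 (Coprime.sym (Coprime.1-coprimeTo n))
ℕtoℚ≡mkℚ n = ℚₚ.normalize-coprime (Coprime.sym (Coprime.1-coprimeTo n))

ℕtoℚ-* : ∀ a b → ℕtoℚ (a * b) ≡ ℕtoℚ a ℚ.* ℕtoℚ b
ℕtoℚ-* a b rewrite ℕtoℚ≡mkℚ a | ℕtoℚ≡mkℚ b = cong (ℚ._/ 1) (ℤₚ.pos-* a b)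

ℕtoℚ-mono-≤ : ∀ {a b} → a ≤ b → ℕtoℚ a ℚ.≤ ℕtoℚ b
ℕtoℚ-mono-≤ {a} {b} a≤b rewrite ℕtoℚ≡mkℚ a | ℕtoℚ≡mkℚ b =
  ℚ.*≤* (subst₂ ℤ._≤_ (sym (ℤₚ.*-identityʳ (ℤ.+ a))) (sym (ℤₚ.*-identityʳ (ℤ.+ b))) (ℤ.+≤+ a≤b))

ℕtoℚ-cancel-≤ : ∀ {a b} → ℕtoℚ a ℚ.≤ ℕtoℚ b → a ≤ b
ℕtoℚ-cancel-≤ {a} {b} a≤b rewrite ℕtoℚ≡mkℚ a | ℕtoℚ≡mkℚ b with a≤b
... | ℚ.*≤* a*1≤b*1 = ℤₚ.drop‿+≤+ (subst₂ ℤ._≤_ (ℤₚ.*-identityʳ (ℤ.+ a)) (ℤₚ.*-identityʳ (ℤ.+ b)) a*1≤b*1)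

1ℚ*ℕtoℚ-≤⇒≤ : ∀ {a b} → 1ℚ ℚ.* ℕtoℚ a ℚ.≤ ℕtoℚ b → a ≤ b
1ℚ*ℕtoℚ-≤⇒≤ {a} {b} = ℕtoℚ-cancel-≤ ∘ subst (ℚ._≤ ℕtoℚ b) (ℚₚ.*-identityˡ (ℕtoℚ a))

≤⇒1ℚ*ℕtoℚ-≤ : ∀ {a b} → a ≤ b → 1ℚ ℚ.* ℕtoℚ a ℚ.≤ ℕtoℚ b
≤⇒1ℚ*ℕtoℚ-≤ {a} {b} = subst (ℚ._≤ ℕtoℚ b) (sym (ℚₚ.*-identityˡ (ℕtoℚ a))) ∘ ℕtoℚ-mono-≤

*-ℕtoℚ-scale : ∀ (r : ℚ) c a b → r ℚ.* ℕtoℚ a ≡ ℕtoℚ b → r ℚ.* ℕtoℚ (c * a) ≡ ℕtoℚ (c * b)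
*-ℕtoℚ-scale r c a b ra≡b = begin
  r ℚ.* ℕtoℚ (c * a)              ≡⟨ cong (r ℚ.*_) (ℕtoℚ-* c a) ⟩
  r ℚ.* (ℕtoℚ c ℚ.* ℕtoℚ a)       ≡⟨ ℚₚ.*-assoc r _ _ ⟨
  r ℚ.* ℕtoℚ c ℚ.* ℕtoℚ a         ≡⟨ cong (ℚ._* ℕtoℚ a) (ℚₚ.*-comm r _) ⟩
  ℕtoℚ c ℚ.* r ℚ.* ℕtoℚ a         ≡⟨ ℚₚ.*-assoc (ℕtoℚ c) r _ ⟩
  ℕtoℚ c ℚ.* (r ℚ.* ℕtoℚ a)       ≡⟨ cong (ℕtoℚ c ℚ.*_) ra≡b ⟩
  ℕtoℚ c ℚ.* ℕtoℚ b               ≡⟨ ℕtoℚ-* c b ⟨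
  ℕtoℚ (c * b)                    ∎
  where open ≡-Reasoning

commonMultiple : ∀ {n} (t : Fin n → ℕ) → (∀ i → 1 ≤ t i) → ∃ λ T → 1 ≤ T × (∀ i → t i ∣ T)
commonMultiple {zero}  t t≥1 = 1 , ≤-refl , λ ()
commonMultiple {suc n} t t≥1 =
  let (T , T≥1 , t∣T) = commonMultiple (t ∘ suc) (t≥1 ∘ suc) in
  t zero * T , *-mono-≤ (t≥1 zero) T≥1 , λ { zero → m∣m*n T ; (suc i) → ∣-trans (t∣T i) (n∣m*n (t zero)) }

module Cyclic (K : ℕ) .{{_ : NonZero K}} where

  _⊕_ : Fin K → Fin K → Fin K
  i ⊕ j = (toℕ i + toℕ j) mod K

  ⊕-comm : ∀ i j → i ⊕ j ≡ j ⊕ i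
  ⊕-comm i j = cong (_mod K) (+-comm (toℕ i) (toℕ j))

  -- b is recovered from (a + b) mod K by adding K - a
  ⊕-cancelˡ : ∀ i {j j′} → i ⊕ j ≡ i ⊕ j′ → j ≡ j′
  ⊕-cancelˡ i {j} {j′} e = Finₚ.toℕ-injective (begin
    toℕ j                                   ≡⟨ recover (toℕ j) (Finₚ.toℕ<n j) ⟩
    ((toℕ i + toℕ j) % K + (K ∸ toℕ i) % K) % K
      ≡⟨ cong (λ r → (r + (K ∸ toℕ i) % K) % K) (trans (sym (toℕ-⊕ j)) (trans (cong toℕ e) (toℕ-⊕ j′))) ⟩
    ((toℕ i + toℕ j′) % K + (K ∸ toℕ i) % K) % K ≡⟨ recover (toℕ j′) (Finₚ.toℕ<n j′) ⟨
    toℕ j′                                  ∎)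
    where
    open ≡-Reasoning
    toℕ-⊕ : ∀ j → toℕ (i ⊕ j) ≡ (toℕ i + toℕ j) % K
    toℕ-⊕ j = Finₚ.toℕ-fromℕ< (m%n<n (toℕ i + toℕ j) K)
    recover : ∀ b → b < K → b ≡ ((toℕ i + b) % K + (K ∸ toℕ i) % K) % K
    recover b b<K = begin
      b                                       ≡⟨ m<n⇒m%n≡m b<K ⟨
      b % K                                   ≡⟨ [m+n]%n≡m%n b K ⟨
      (b + K) % K                             ≡⟨ cong (_% K) (b+K≡ b) ⟩
      (toℕ i + b + (K ∸ toℕ i)) % K           ≡⟨ %-distribˡ-+ (toℕ i + b) (K ∸ toℕ i) K ⟩
      ((toℕ i + b) % K + (K ∸ toℕ i) % K) % K ∎
      where
      b+K≡ : ∀ b → b + K ≡ toℕ i + b + (K ∸ toℕ i)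
      b+K≡ b = begin
        b + K                          ≡⟨ cong (b +_) (m+[n∸m]≡n (<⇒≤ (Finₚ.toℕ<n i))) ⟨
        b + (toℕ i + (K ∸ toℕ i))      ≡⟨ +-assoc b (toℕ i) _ ⟨
        b + toℕ i + (K ∸ toℕ i)        ≡⟨ cong (_+ (K ∸ toℕ i)) (+-comm b (toℕ i)) ⟩
        toℕ i + b + (K ∸ toℕ i)        ∎

  ⊕-solvable : ∀ c i → ∃ λ j → j ⊕ c ≡ i
  ⊕-solvable c = injective⇒surjective {f = _⊕ c} (λ {j} {j′} e → ⊕-cancelˡ c (trans (⊕-comm c j) (trans e (⊕-comm j′ c)))) ≤-refl

  rotate : Fin K → Fin (suc K) → Fin (suc K)
  rotate j zero    = zero
  rotate j (suc c) = suc (j ⊕ c)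

  rotate-injective : ∀ j {c c′} → rotate j c ≡ rotate j c′ → c ≡ c′
  rotate-injective j {zero}  {zero}  _ = refl
  rotate-injective j {suc c} {suc c′} e = cong suc (⊕-cancelˡ j (Finₚ.suc-injective e))

  rotate≡zero : ∀ j c → rotate j c ≡ zero → c ≡ zero
  rotate≡zero j zero _ = refl

  #-rotate-zero : ∀ i → #[ (λ j → rotate j zero Fin.≟ suc i) ] ≡ 0
  #-rotate-zero i = #-none (λ j → rotate j zero Fin.≟ suc i) (λ j ())

  #-rotate-suc : ∀ c i → #[ (λ j → rotate j (suc c) Fin.≟ suc i) ] ≡ 1
  #-rotate-suc c i = let (j , j⊕c≡i) = ⊕-solvable c i in
    #-unique (λ j → rotate j (suc c) Fin.≟ suc i) j (cong suc j⊕c≡i)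
      (λ j′ e → ⊕-cancelˡ c (trans (⊕-comm c j′) (trans (Finₚ.suc-injective e) (trans (sym j⊕c≡i) (⊕-comm j c)))))

  #-rotate : ∀ c i → #[ (λ j → rotate j c Fin.≟ suc i) ] ≡ 𝟙 (¬? (c Fin.≟ zero))
  #-rotate zero    i = #-rotate-zero i
  #-rotate (suc c) i = #-rotate-suc c i

injective? : ∀ {m n} (g : Fin m → Fin n) → Dec (Injective _≡_ _≡_ g)
injective? g = map′ (λ inj {x} {y} → inj x y) (λ inj x y → inj)
  (Finₚ.all? (λ x → Finₚ.all? (λ y → (g x Fin.≟ g y) →-dec (x Fin.≟ y))))

colourable-pullback : ∀ {F F′ : Graph} (h : Fin (n F) → Fin (n F′)) → (∀ u v → Adj F u v → Adj F′ (h u) (h v)) →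
                      ∀ {c} → Colourable F′ c → Colourable F c
colourable-pullback h hom (col , proper) = col ∘ h , λ u v uv → proper (h u) (h v) (hom u v uv)

classSize-permute : ∀ (F : Graph) {k} (col : Fin (n F) → Fin k) (π : Permutation′ k) c →
                    classSize F ((π ⟨$⟩ʳ_) ∘ col) (π ⟨$⟩ʳ c) ≡ classSize F col c
classSize-permute F col π c = #-cong (λ x → π ⟨$⟩ʳ col x Fin.≟ π ⟨$⟩ʳ c) (λ x → col x Fin.≟ c)
  (λ x → mk⇔ (permutation-injective π) (cong (π ⟨$⟩ʳ_)))

transpose-to-zero : ∀ {k} (c : Fin (suc k)) → transpose c zero ⟨$⟩ʳ c ≡ zero
transpose-to-zero c rewrite dec-true (c Fin.≟ c) refl = refl

module Relabelling (H : OrderedGraph) (B : Multipartite) (bottle : IsBottlegraph H B)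
                   {k} (col : Fin (N B) → Fin k) (proper : ProperColouring (asGraph B) k col)
                   (samePart⇒sameColour : ∀ u w → part B u ≡ part B w → col u ≡ col w) where

  κ : (Fin k → Fin k) → Fin (N B) → ℕ
  κ g x = toℕ (g (col x))

  ψ : (Fin k → Fin k) → Permutation′ (N B)
  ψ g = Ranking.ranking (κ g)

  -- the key of a part is that of any of its vertices, and 0 for an empty part
  partKey : (Fin k → Fin k) → Fin (Multipartite.k B) → ℕ
  partKey g u with Finₚ.any? (λ x → part B x Fin.≟ u)
  ... | yes (x , _) = κ g x
  ... | no  _       = 0

  partKey-part : ∀ g v → partKey g (part B v) ≡ κ g v
  partKey-part g v with Finₚ.any? (λ x → part B x Fin.≟ part B v)
  ... | yes (x , px≡pv) = cong (toℕ ∘ g) (samePart⇒sameColour x v px≡pv)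
  ... | no  none        = ⊥-elim (none (v , refl))

  ψ-isInterval : ∀ g → Injective _≡_ _≡_ g → IsIntervalLabelling B (Ranking.ranking (partKey g)) (ψ g)
  ψ-isInterval g g-inj u v σu<σv = Ranking.ranking-mono (κ g) u v (≤∧≢⇒< κu≤κv κu≢κv)
    where
    κu≤κv : κ g u ≤ κ g v
    κu≤κv = subst₂ _≤_ (partKey-part g u) (partKey-part g v) (Ranking.ranking-reflects (partKey g) (part B u) (part B v) σu<σv)
    κu≢κv : κ g u ≢ κ g v
    κu≢κv e = proper u v (λ pu≡pv → Finₚ.<-irrefl (cong (Ranking.ranking (partKey g) ⟨$⟩ʳ_) pu≡pv) σu<σv)
                         (g-inj (Finₚ.toℕ-injective e))

  tileSize : ∀ g → ∃ λ t → 1 ≤ t × (Injective _≡_ _≡_ g → PerfectTiling H (orderedBlowup B (ψ g) t))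
  tileSize g = choose (injective? g)
    where
    choose : Dec (Injective _≡_ _≡_ g) → ∃ λ t → 1 ≤ t × (Injective _≡_ _≡_ g → PerfectTiling H (orderedBlowup B (ψ g) t))
    choose (yes g-inj) = let (t , t≥1 , tiling) = bottle (Ranking.ranking (partKey g)) (ψ g) (ψ-isInterval g g-inj) in
                         t , t≥1 , λ _ → tiling
    choose (no ¬inj)   = 1 , ≤-refl , λ g-inj → ⊥-elim (¬inj g-inj)

  -- relabellings are encoded as elements of Fin (k ^ k) so that they can be handled simultaneously
  normalise : (Fin k → Fin k) → Fin k → Fin k
  normalise g = finToFun (funToFin g)

  normalise-≗ : ∀ g c → normalise g c ≡ g c
  normalise-≗ g = Finₚ.finToFun-funToFin g

  commonTileSize : ∃ λ T → 1 ≤ T × (∀ g → Injective _≡_ _≡_ g → PerfectTiling H (orderedBlowup B (ψ (normalise g)) T))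
  commonTileSize =
    let (T , T≥1 , t∣T) = commonMultiple (λ code → proj₁ (tileSize (finToFun code))) (λ code → proj₁ (proj₂ (tileSize (finToFun code)))) in
    T , T≥1 , λ g g-inj → tilingAt T (t∣T (funToFin g)) g-inj
    where
    tilingAt : ∀ T {g} → proj₁ (tileSize (normalise g)) ∣ T → Injective _≡_ _≡_ g →
               PerfectTiling H (orderedBlowup B (ψ (normalise g)) T)
    tilingAt T {g} (divides u T≡ut) g-inj = subst (λ T → PerfectTiling H (orderedBlowup B (ψ (normalise g)) T))
      (trans (*-comm t u) (sym T≡ut))
      (perfectTiling-blowup-* B (ψ (normalise g)) t u (proj₂ (proj₂ (tileSize (normalise g))) normalise-inj))
      where
      t : ℕ
      t = proj₁ (tileSize (normalise g))
      normalise-inj : Injective _≡_ _≡_ (normalise g)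
      normalise-inj {x} {y} e = g-inj (trans (sym (normalise-≗ g x)) (trans e (normalise-≗ g y)))

module Construction (H : OrderedGraph) (B : Multipartite) (bottle : IsBottlegraph H B) (K′ : ℕ)
                    (col : Fin (N B) → Fin (suc (suc K′))) (χB : IsChromaticNumber (asGraph B) (suc (suc K′)))
                    (proper : ProperColouring (asGraph B) (suc (suc K′)) col)
                    (s : ℕ) (class₀ : classSize (asGraph B) col zero ≡ s)
                    (classMin : ∀ c → s ≤ classSize (asGraph B) col c) (s<N : s < N B) where

  K : ℕ
  K = suc K′
  open Relabelling H B bottle col proper (chromatic⇒samePart⇒sameColour B χB proper)
  open Cyclic K

  module _ (T : ℕ) (T≥1 : 1 ≤ T)
           (tilingFor : ∀ g → Injective _≡_ _≡_ g → PerfectTiling H (orderedBlowup B (ψ (normalise g)) T)) where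

    -- vertices of B′: K copies of B(T); copy j recolours colour 0 to part 0 and rotates the other colours
    part′ : Fin (K * (N B * T)) → Fin (suc K)
    part′ y = rotate (quotient (N B * T) y) (col (quotient T (remainder {K} (N B * T) y)))

    B′ : Multipartite
    B′ = record { k = suc K ; N = K * (N B * T) ; part = part′ }

    #-part′ : ∀ {P : Fin (suc K) → Set} (P? : ∀ c → Dec (P c)) →
              #[ (λ y → P? (part′ y)) ] ≡ ∑[ j < K ] (T * #[ (λ x → P? (rotate j (col x))) ])
    #-part′ P? = trans (#-combine K (N B * T) (λ j z → P? (rotate j (col (quotient T z)))))
                       (sum-cong-≗ (λ j → #-blowup (N B) T (λ x → P? (rotate j (col x)))))

    partSize-zero : partSize B′ zero ≡ K * (T * s)
    partSize-zero = begin
      partSize B′ zero                                          ≡⟨ #-part′ (Fin._≟ zero) ⟩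
      ∑[ j < K ] (T * #[ (λ x → rotate j (col x) Fin.≟ zero) ]) ≡⟨ sum-cong-≗ (λ j → cong (T *_) (trans (#-cong (λ x → rotate j (col x) Fin.≟ zero) (λ x → col x Fin.≟ zero)
                                                                      (λ x → mk⇔ (rotate≡zero j (col x)) (λ { e → cong (rotate j) e }))) class₀)) ⟩
      ∑[ j < K ] (T * s)                                        ≡⟨ ∑-const K (T * s) ⟩
      K * (T * s)                                               ∎
      where open ≡-Reasoning

    partSize-suc : ∀ i → partSize B′ (suc i) ≡ T * (N B ∸ s)
    partSize-suc i = begin
      partSize B′ (suc i)                                          ≡⟨ #-part′ (Fin._≟ suc i) ⟩
      ∑[ j < K ] (T * #[ (λ x → rotate j (col x) Fin.≟ suc i) ])   ≡⟨ *-distribˡ-sum T (λ j → #[ (λ x → rotate j (col x) Fin.≟ suc i) ]) ⟨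
      T * ∑[ j < K ] #[ (λ x → rotate j (col x) Fin.≟ suc i) ]     ≡⟨ cong (T *_) (∑-#-comm (λ j x → rotate j (col x) Fin.≟ suc i)) ⟩
      T * ∑[ x < N B ] #[ (λ j → rotate j (col x) Fin.≟ suc i) ]   ≡⟨ cong (T *_) (sum-cong-≗ (λ x → #-rotate (col x) i)) ⟩
      T * ∑[ x < N B ] 𝟙 (¬? (col x Fin.≟ zero))                  ≡⟨ cong (T *_) (count≡∑ (λ x → does (¬? (col x Fin.≟ zero)))) ⟨
      T * #[ (λ x → ¬? (col x Fin.≟ zero)) ]                       ≡⟨ cong (T *_) othersCount ⟩
      T * (N B ∸ s)                                                ∎
      where
      open ≡-Reasoning
      othersCount : #[ (λ x → ¬? (col x Fin.≟ zero)) ] ≡ N B ∸ s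
      othersCount = begin
        #[ (λ x → ¬? (col x Fin.≟ zero)) ]           ≡⟨ m+n∸m≡n s _ ⟨
        s + #[ (λ x → ¬? (col x Fin.≟ zero)) ] ∸ s   ≡⟨ cong (λ z → z + _ ∸ s) class₀ ⟨
        classSize (asGraph B) col zero + #[ (λ x → ¬? (col x Fin.≟ zero)) ] ∸ s ≡⟨ cong (_∸ s) (#-∁ (λ x → col x Fin.≟ zero)) ⟩
        N B ∸ s                                      ∎

    instance
      T-nonZero : NonZero T
      T-nonZero = >-nonZero T≥1

    K*s≤N∸s : K * s ≤ N B ∸ s
    K*s≤N∸s = subst (_≤ N B ∸ s) (m+n∸m≡n s (K * s)) (∸-monoˡ-≤ s (begin
      suc K * s                                      ≡⟨ ∑-const (suc K) s ⟨
      ∑[ c < suc K ] s                               ≤⟨ ∑-mono-≤ classMin ⟩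
      ∑[ c < suc K ] classSize (asGraph B) col c     ≡⟨ ∑-#-fibres col ⟩
      N B                                            ∎))
      where open ≤-Reasoning

    s′ : ℕ
    s′ = K * (T * s)

    s′≤T*[N∸s] : s′ ≤ T * (N B ∸ s)
    s′≤T*[N∸s] = subst (_≤ T * (N B ∸ s)) (regroup K T s) (*-monoʳ-≤ T K*s≤N∸s)
      where
      regroup : ∀ K T s → T * (K * s) ≡ K * (T * s)
      regroup = solve-∀

    s′≤partSize : ∀ c → s′ ≤ partSize B′ c
    s′≤partSize zero    = ≤-reflexive (sym partSize-zero)
    s′≤partSize (suc i) = subst (s′ ≤_) (sym (partSize-suc i)) s′≤T*[N∸s]

    -- copy 0 of B(T) restricted to the first vertex of each block is a copy of B
    copy₀ : Fin (N B) → Fin (N B′)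
    copy₀ x = combine {K} zero (combine x (Fin.fromℕ< T≥1))

    part′-copy₀ : ∀ x → part′ (copy₀ x) ≡ rotate zero (col x)
    part′-copy₀ x = cong₂ rotate (cong proj₁ (Finₚ.remQuot-combine {K} {N B * T} zero (combine x first)))
      (cong col (trans (cong (quotient T) (cong proj₂ (Finₚ.remQuot-combine {K} {N B * T} zero (combine x first))))
                       (cong proj₁ (Finₚ.remQuot-combine {N B} {T} x first))))
      where
      first : Fin T
      first = Fin.fromℕ< T≥1

    χB′ : IsChromaticNumber (asGraph B′) (suc K)
    χB′ = (part′ , λ u v pu≢pv → pu≢pv) , λ c colourable → proj₂ χB c (colourable-pullback copy₀ hom colourable)
      where
      hom : ∀ u v → Adj (asGraph B) u v → Adj (asGraph B′) (copy₀ u) (copy₀ v)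
      hom u v pu≢pv e = proper u v pu≢pv (rotate-injective zero (trans (sym (part′-copy₀ u)) (trans e (part′-copy₀ v))))

    σB′ : IsSigma (asGraph B′) s′
    σB′ = suc K , χB′ , (part′ , (λ u v pu≢pv → pu≢pv) , zero , partSize-zero) , minimal
      where
      minimal : ∀ s″ → AchievesClassSize (asGraph B′) (suc K) s″ → s′ ≤ s″
      minimal s″ (col′ , proper′ , c , size≡s″) = let (y , class≡part) = colourClass-isPart B′ χB′ proper′ c in
        subst (s′ ≤_) (trans (sym class≡part) size≡s″) (s′≤partSize (part′ y))

    χcrB′ : ∀ r → r ℚ.* ℕtoℚ (N B ∸ s) ≡ ℕtoℚ (K * N B) → IsChiCr (asGraph B′) r
    χcrB′ r χcrB = suc K , s′ , χB′ , σB′ , *-monoʳ-< K (subst (T * s <_) (*-comm T (N B)) (*-monoʳ-< T s<N)) ,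
      subst₂ (λ a b → r ℚ.* ℕtoℚ a ≡ ℕtoℚ b) (sym size−s′) (sym K*size) (*-ℕtoℚ-scale r (K * T) (N B ∸ s) (K * N B) χcrB)
      where
      size−s′ : K * (N B * T) ∸ s′ ≡ K * T * (N B ∸ s)
      size−s′ = begin
        K * (N B * T) ∸ K * (T * s) ≡⟨ cong₂ _∸_ (regroup₁ K (N B) T) (sym (*-assoc K T s)) ⟩
        K * T * N B ∸ K * T * s     ≡⟨ *-distribˡ-∸ (K * T) (N B) s ⟨
        K * T * (N B ∸ s)           ∎
        where
        open ≡-Reasoning
        regroup₁ : ∀ K N T → K * (N * T) ≡ K * T * N
        regroup₁ = solve-∀
      K*size : K * (K * (N B * T)) ≡ K * T * (K * N B)
      K*size = regroup₂ K (N B) T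
        where
        regroup₂ : ∀ K N T → K * (K * (N * T)) ≡ K * T * (K * N)
        regroup₂ = solve-∀

    balanced : ∃ λ m → ∀ (i : Fin (suc K)) → (toℕ i ≡ 0 → partSize B′ i ≤ m) × (¬ toℕ i ≡ 0 → partSize B′ i ≡ m)
    balanced = T * (N B ∸ s) , λ
      { zero    → (λ _ → subst (_≤ T * (N B ∸ s)) (sym partSize-zero) s′≤T*[N∸s]) , (λ 0≢0 → ⊥-elim (0≢0 refl))
      ; (suc i) → (λ ()) , (λ _ → partSize-suc i) }

    module Tiles (σ′ : Permutation′ (suc K)) (φ′ : Permutation′ (N B′)) (interval : IsIntervalLabelling B′ σ′ φ′) where

      key : Fin (N B′) → ℕ
      key y = toℕ (σ′ ⟨$⟩ʳ part′ (φ′ ⟨$⟩ˡ y))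

      key-mono : ∀ p q → toℕ p ≤ toℕ q → key p ≤ key q
      key-mono p q p≤q = ≮⇒≥ λ kq<kp → <-irrefl refl (≤-<-trans p≤q
        (subst₂ (λ a b → toℕ a < toℕ b) (inverseʳ φ′) (inverseʳ φ′) (interval (φ′ ⟨$⟩ˡ q) (φ′ ⟨$⟩ˡ p) kq<kp)))

      key-edge : ∀ p q → key p ≢ key q → E (orderedB B′ φ′) p q
      key-edge p q kp≢kq e = kp≢kq (cong (λ c → toℕ (σ′ ⟨$⟩ʳ c)) e)

      g : Fin K → Fin (suc K) → Fin (suc K)
      g j c = σ′ ⟨$⟩ʳ rotate j c

      g-injective : ∀ j → Injective _≡_ _≡_ (g j)
      g-injective j e = rotate-injective j (permutation-injective σ′ e)

      gₙ : Fin K → Fin (suc K) → Fin (suc K)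
      gₙ j = normalise (g j)

      gₙ-injective : ∀ j → Injective _≡_ _≡_ (gₙ j)
      gₙ-injective j {x} {y} e = g-injective j (trans (sym (normalise-≗ (g j) x)) (trans e (normalise-≗ (g j) y)))

      piece : Fin K → Piece H
      piece j = record
        { graph    = orderedBlowup B (ψ (gₙ j)) T
        ; key      = λ p → κ (gₙ j) (ψ (gₙ j) ⟨$⟩ˡ quotient T p)
        ; key-mono = λ p q p≤q → Ranking.key-mono-ranking⁻¹ (κ (gₙ j)) _ _ (quotient-mono T p q p≤q)
        ; key-edge = λ p q pq e → proper _ _ pq (gₙ-injective j (Finₚ.toℕ-injective e))
        ; tiling   = proj₁ (tilingFor (g j) (g-injective j))
        ; perfect  = perfect⇒size≤covered (proj₁ (tilingFor (g j) (g-injective j))) (proj₂ (tilingFor (g j) (g-injective j))) }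

      width-piece : ∀ j v → Piece.width (piece j) v ≡ T * #[ (λ x → toℕ (g j (col x)) ≟ v) ]
      width-piece j v = begin
        #[ (λ p → κ (gₙ j) (ψ (gₙ j) ⟨$⟩ˡ quotient T p) ≟ v) ] ≡⟨ #-blowup (N B) T (λ x → κ (gₙ j) (ψ (gₙ j) ⟨$⟩ˡ x) ≟ v) ⟩
        T * #[ (λ x → κ (gₙ j) (ψ (gₙ j) ⟨$⟩ˡ x) ≟ v) ]         ≡⟨ cong (T *_) (#-permute (λ x → κ (gₙ j) x ≟ v) (ψ (gₙ j))) ⟩
        T * #[ (λ x → κ (gₙ j) x ≟ v) ]                         ≡⟨ cong (T *_) (count-cong (λ x → cong (λ c → does (toℕ c ≟ v)) (normalise-≗ (g j) (col x)))) ⟩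
        T * #[ (λ x → toℕ (g j (col x)) ≟ v) ]                  ∎
        where open ≡-Reasoning

      width-G : ∀ v → Blocks.width key key-mono v ≡ ∑[ j < K ] (T * #[ (λ x → toℕ (g j (col x)) ≟ v) ])
      width-G v = trans (#-permute (λ y → toℕ (σ′ ⟨$⟩ʳ part′ y) ≟ v) φ′) (#-part′ (λ c → toℕ (σ′ ⟨$⟩ʳ c) ≟ v))

      tiling : XTiling 1ℚ H (orderedB B′ φ′)
      tiling = let (T′ , covers , _) = assemble (λ _ → 0) piece fits in
        T′ , ≤⇒1ℚ*ℕtoℚ-≤ (subst (_≤ covered T′) (∑-const K (N B * T)) covers)
        where
        open Assembly key key-mono key-edge
        fits : ∀ v → 0 + ∑[ j < K ] Piece.width (piece j) v ≤ Blocks.width key key-mono v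
        fits v = ≤-reflexive (trans (sum-cong-≗ (λ j → width-piece j v)) (sym (width-G v)))

    isOneBottlegraph : IsXBottlegraph 1ℚ H B′
    isOneBottlegraph = balanced , Tiles.tiling

chromaticNumber-unique : ∀ {F k k′} → IsChromaticNumber F k → IsChromaticNumber F k′ → k ≡ k′
chromaticNumber-unique (colourable , least) (colourable′ , least′) = ≤-antisym (least _ colourable′) (least′ _ colourable)

orderedB↪blowup₁ : ∀ B φ → IsEmbedding (orderedB B φ) (orderedBlowup B φ 1) (λ x → combine x zero)
orderedB↪blowup₁ B φ = (λ p q p<q → Finₚ.combine-monoˡ-< zero zero p<q) , edge
  where
  block : ∀ x → quotient {N B} 1 (combine x zero) ≡ x
  block x = cong proj₁ (Finₚ.remQuot-combine {N B} {1} x zero)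
  edge : ∀ p q → E (orderedB B φ) p q → blowupEdge B φ 1 (combine p zero) (combine q zero)
  edge p q pq rewrite block p | block q = pq

oneBottlegraph⇒bottlegraph : ∀ {H B} → IsXBottlegraph 1ℚ H B → IsBottlegraph H B
oneBottlegraph⇒bottlegraph {H} {B} (_ , tiles) σ φ interval =
  let (T , covers) = tiles σ φ interval
      T₁ = mapTiling (λ x → combine x zero) (orderedB↪blowup₁ B φ) T in
  1 , ≤-refl , T₁ , size≤covered⇒perfect T₁ (subst (_≤ covered T) (sym (*-identityʳ (N B))) (1ℚ*ℕtoℚ-≤⇒≤ covers))

bottlegraph⇒oneBottlegraph : ∀ {H B r} → IsBottlegraph H B → IsChiCr (asGraph B) r →
                             ∃ λ B′ → IsXBottlegraph 1ℚ H B′ × IsChiCr (asGraph B′) r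
bottlegraph⇒oneBottlegraph {H} {B} {r} bottle (k , s , χk , (k′ , χk′ , (col , proper , c₀ , class≡s) , minimal) , s<N , χcr)
  with chromaticNumber-unique χk χk′
... | refl = build k χk col proper c₀ class≡s minimal χcr
  where
  build : ∀ k → IsChromaticNumber (asGraph B) k → (col : Fin (N B) → Fin k) → ProperColouring (asGraph B) k col →
          (c₀ : Fin k) → classSize (asGraph B) col c₀ ≡ s → (∀ s″ → AchievesClassSize (asGraph B) k s″ → s ≤ s″) →
          r ℚ.* ℕtoℚ (N B ∸ s) ≡ ℕtoℚ ((k ∸ 1) * N B) → ∃ λ B′ → IsXBottlegraph 1ℚ H B′ × IsChiCr (asGraph B′) r
  build (suc zero) χ col proper zero class≡s minimal χcr =
    ⊥-elim (<-irrefl (trans (sym class≡s) (#-all (λ x → col x Fin.≟ zero) (λ x → Fin1-unique (col x)))) s<N)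
    where
    Fin1-unique : ∀ (c : Fin 1) → c ≡ zero
    Fin1-unique zero = refl
  build (suc (suc K′)) χ col proper c₀ class≡s minimal χcr =
    let (T , T≥1 , tilingFor) = Relabelling.commonTileSize H B bottle col₀ proper₀ sameColour₀ in
    C.B′ T T≥1 tilingFor , C.isOneBottlegraph T T≥1 tilingFor , C.χcrB′ T T≥1 tilingFor r χcr
    where
    π : Permutation′ (suc (suc K′))
    π = transpose c₀ zero
    col₀ : Fin (N B) → Fin (suc (suc K′))
    col₀ = (π ⟨$⟩ʳ_) ∘ col
    proper₀ : ProperColouring (asGraph B) (suc (suc K′)) col₀
    proper₀ u v uv e = proper u v uv (permutation-injective π e)
    sameColour₀ : ∀ u w → part B u ≡ part B w → col₀ u ≡ col₀ w
    sameColour₀ = chromatic⇒samePart⇒sameColour B χ proper₀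
    class₀ : classSize (asGraph B) col₀ zero ≡ s
    class₀ = subst (λ c → classSize (asGraph B) col₀ c ≡ s) (transpose-to-zero c₀) (trans (classSize-permute (asGraph B) col π c₀) class≡s)
    classMin : ∀ c → s ≤ classSize (asGraph B) col₀ c
    classMin c = minimal _ (col₀ , proper₀ , c , refl)
    module C = Construction H B bottle K′ col₀ χ proper₀ s class₀ classMin s<N

proposition5p2 : (H : OrderedGraph) → (q : ℚ) →
    (LowerBoundChiStar H q → LowerBoundChiStarX 1ℚ H q)
    × (LowerBoundChiStarX 1ℚ H q → LowerBoundChiStar H q)
proposition5p2 H q = bound-for-bottlegraphs , bound-for-oneBottlegraphs
  where
  bound-for-bottlegraphs : LowerBoundChiStar H q → LowerBoundChiStarX 1ℚ H q
  bound-for-bottlegraphs q≤ B r oneBottle χcr = q≤ B r (oneBottlegraph⇒bottlegraph oneBottle) χcr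
  bound-for-oneBottlegraphs : LowerBoundChiStarX 1ℚ H q → LowerBoundChiStar H q
  bound-for-oneBottlegraphs q≤ B r bottle χcr =
    let (B′ , oneBottle , χcr′) = bottlegraph⇒oneBottlegraph {H} {B} {r} bottle χcr in q≤ B′ r oneBottle χcr′
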